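{- There exists a function $f$ such that for every positive integer $n$ and each $\mathscr{X}\in\{\mathscr{M}^{KI},\mathscr{M}^{KK},\mathscr{A}^{KK},\mathscr{H}^{KK}\}$, we have $\mathrm{rw}(Q_{f(n)}(\mathscr{X}_{f(n)}))\ge n$.
   Context: All graphs finite and simple. For positive integers $k,n$, let $X^i=\{x^i_1,\dots,x^i_n\}$ ($i\in[k]$) be pairwise disjoint sets, and $y^1,\dots,y^k$, $z^1,\dots,z^{k-1}$ further distinct vertices. Define: $Q_k(\mathscr{M}^{KK}_n)$: vertex set $\bigcup_i X^i\cup\{y^1,\dots,y^k\}$, edges $x^i_jx^{i+1}_j$ for $i\in[k-1]$, $j\in[n]$, and each $X^i\cup\{y^i\}$ is a clique. $Q_k(\mathscr{M}^{KI}_n)$: vertex set $\bigcup_i X^i\cup\{y^i: i\le k\text{ odd}\}$, edges $x^i_jx^{i+1}_j$ for $i\in[k-1]$, $j\in[n]$, and $X^i\cup\{y^i\}$ a clique for each odd $i\le k$ (no other edges). $Q_k(\mathscr{H}^{KK}_n)$: vertex set $\bigcup_i X^i\cup\{y^1,\dots,y^k\}$, edges $x^i_jx^{i+1}_l$ for $i\in[k-1]$, $j\le l$, and each $X^i\cup\{y^i\}$ a clique. $Q_k(\mathscr{A}^{KK}_n)$: vertex set $\bigcup_i X^i\cup\{y^1,\dots,y^k\}\cup\{z^1,\dots,z^{k-1}\}$, edges $x^i_jx^{i+1}_l$ for $i\in[k-1]$, $j\ne l$, each $X^i\cup\{y^i\}$ a clique, and $z^i$ adjacent to all of $X^i\cup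 X^{i+1}$. Rankwidth: a rank-decomposition of $G$ is $(T,\delta)$ with $T$ a tree whose internal nodes have degree 3 and $\delta$ a bijection from the leaves of $T$ to $V(G)$; each edge $e$ of $T$ determines $X_e=\delta(\text{leaves of one component of }T-e)$ and has cutrank equal to the $\mathbb{F}_2$-rank of the submatrix of the adjacency matrix of $G$ with rows $X_e$ and columns $V(G)\setminus X_e$; $\mathrm{rw}(G)$ is the minimum over rank-decompositions of the maximum cutrank of an edge. -}

module Defs where

open import Data.Bool using (Bool; true; false; _∧_; _∨_; not; _xor_; T; if_then_else_)
open import Data.Nat using (ℕ; zero; suc; _≡ᵇ_; _<ᵇ_; _≤ᵇ_; _≤_; _+_)
open import Data.Fin using (Fin; toℕ)
open import Data.Product using (Σ; ∃-syntax; _×_; _,_)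
open import Data.Sum using (_⊎_)
open import Data.Unit using (⊤)
open import Data.List using (List; []; _∷_; length; _++_; [_])
open import Data.List.Relation.Unary.Unique.Propositional using (Unique)
open import Relation.Binary.PropositionalEquality using (_≡_)
open import Relation.Nullary using (¬_)

-- Graphs (vertex type + Boolean adjacency).  The concrete graphs below are
-- finite and simple (adjacency is symmetric by construction, irreflexive).

record Graph : Set₁ where
  field
    V   : Set
    adj : V → V → Bool

record SimpleGraphOn (t : ℕ) : Set where
  field
    adj    : Fin t → Fin t → Bool
    sym    : ∀ u v → adj u v ≡ adj v u
    irrefl : ∀ u → adj u u ≡ false

count : ∀ {t} → (Fin t → Bool) → ℕ
count {zero}  p = 0
count {suc t} p = (if p Fin.zero then 1 else 0) + count (λ i → p (Fin.suc i))

degree : ∀ {t} → SimpleGraphOn t → Fin t → ℕ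
degree T v = count (SimpleGraphOn.adj T v)

data Reach {V : Set} (adj : V → V → Bool) : V → V → Set where
  here : ∀ {a} → Reach adj a a
  step : ∀ {a b c} → adj a b ≡ true → Reach adj b c → Reach adj a c

ConsecAdj : {V : Set} → (V → V → Bool) → List V → Set
ConsecAdj adj []            = ⊤
ConsecAdj adj (v ∷ [])      = ⊤
ConsecAdj adj (v ∷ w ∷ r)   = adj v w ≡ true × ConsecAdj adj (w ∷ r)

IsCycle : ∀ {t} → SimpleGraphOn t → Fin t → List (Fin t) → Set
IsCycle T v0 rest =
  2 ≤ length rest × Unique (v0 ∷ rest) × ConsecAdj (SimpleGraphOn.adj T) (v0 ∷ rest ++ [ v0 ])

record IsTree {t : ℕ} (T : SimpleGraphOn t) : Set where
  field
    nonempty  : 1 ≤ t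
    connected : ∀ u v → Reach (SimpleGraphOn.adj T) u v
    acyclic   : ∀ v0 rest → ¬ IsCycle T v0 rest

IsLeaf : ∀ {t} → SimpleGraphOn t → Fin t → Set
IsLeaf T v = degree T v ≤ 1

eqFin : ∀ {t} → Fin t → Fin t → Bool
eqFin i j = toℕ i ≡ᵇ toℕ j

deleteEdge : ∀ {t} → (Fin t → Fin t → Bool) → Fin t → Fin t → Fin t → Fin t → Bool
deleteEdge adj u v a b =
  adj a b ∧ not ((eqFin a u ∧ eqFin b v) ∨ (eqFin a v ∧ eqFin b u))

record RankDecomposition (G : Graph) : Set where
  field
    t      : ℕ
    tree   : SimpleGraphOn t
    isTree : IsTree tree
    cubic  : ∀ v → IsLeaf tree v ⊎ degree tree v ≡ 3
    δ      : Fin t → Graph.V G                   -- only its values on leaves matter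
    δ-inj  : ∀ a b → IsLeaf tree a → IsLeaf tree b → δ a ≡ δ b → a ≡ b
    δ-surj : ∀ x → ∃[ a ] (IsLeaf tree a × δ a ≡ x)

-- X_e for the tree edge e = uv: images of the leaves in the component of T - e containing u
Side : {G : Graph} → (D : RankDecomposition G) → Fin (RankDecomposition.t D)
     → Fin (RankDecomposition.t D) → Graph.V G → Set
Side D u v x =
  ∃[ a ] (IsLeaf tree a × Reach (deleteEdge (SimpleGraphOn.adj tree) u v) u a × δ a ≡ x)
  where open RankDecomposition D

xorSum : ∀ {n} → (Fin n → Bool) → Bool
xorSum {zero}  p = false
xorSum {suc n} p = p Fin.zero xor xorSum (λ i → p (Fin.suc i))

-- the F₂-rank of the submatrix of the adjacency matrix with rows A and
-- columns V \ A is at least n: there are n rows (in A) that are linearly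
-- independent over F₂ (rank = maximum number of linearly independent rows)
CutRankAtLeast : (G : Graph) → (Graph.V G → Set) → ℕ → Set
CutRankAtLeast G A n =
  Σ (Fin n → Graph.V G) λ r → ((∀ i → A (r i)) ×
    (∀ (c : Fin n → Bool) →
       (∀ col → ¬ A col → xorSum (λ i → c i ∧ Graph.adj G (r i) col) ≡ false) →
       ∀ i → c i ≡ false))

RankwidthAtLeast : Graph → ℕ → Set
RankwidthAtLeast G n =
  ∀ (D : RankDecomposition G) →
    ∃[ u ] ∃[ v ] (SimpleGraphOn.adj (RankDecomposition.tree D) u v ≡ true ×
                   CutRankAtLeast G (Side D u v) n)

-- The graphs Q_k(𝒳_n).  Layers i ∈ [k] are Fin k (0-based: layer toℕ i + 1),
-- j ∈ [n] is Fin n (0-based).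

isOdd : ℕ → Bool
isOdd zero          = false
isOdd (suc zero)    = true
isOdd (suc (suc m)) = isOdd m

nextLayer : ∀ {k} → Fin k → Fin k → Bool
nextLayer i i' = suc (toℕ i) ≡ᵇ toℕ i'

data VKK (k n : ℕ) : Set where
  x : Fin k → Fin n → VKK k n
  y : Fin k → VKK k n

-- y^i exists only for odd i (1-based), i.e. toℕ i + 1 odd
data VKI (k n : ℕ) : Set where
  x : Fin k → Fin n → VKI k n
  y : (i : Fin k) → T (isOdd (suc (toℕ i))) → VKI k n

-- z^i exists for i ∈ [k-1], i.e. toℕ i + 1 < k
data VA (k n : ℕ) : Set where
  x : Fin k → Fin n → VA k n
  y : Fin k → VA k n
  z : (i : Fin k) → T (suc (toℕ i) <ᵇ k) → VA k n

symm : {V : Set} → (V → V → Bool) → V → V → Bool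
symm E u v = E u v ∨ E v u

EMKK : ∀ {k n} → VKK k n → VKK k n → Bool
EMKK (x i j) (x i' j') = (eqFin i i' ∧ not (eqFin j j')) ∨ (nextLayer i i' ∧ eqFin j j')
EMKK (x i j) (y i')    = eqFin i i'
EMKK _       _         = false

QMKK : ℕ → ℕ → Graph
QMKK k n = record { V = VKK k n ; adj = symm EMKK }

EMKI : ∀ {k n} → VKI k n → VKI k n → Bool
EMKI (x i j) (x i' j') =
  (isOdd (suc (toℕ i)) ∧ eqFin i i' ∧ not (eqFin j j')) ∨ (nextLayer i i' ∧ eqFin j j')
EMKI (x i j) (y i' _)  = eqFin i i'
EMKI _       _         = false

QMKI : ℕ → ℕ → Graph
QMKI k n = record { V = VKI k n ; adj = symm EMKI }

EHKK : ∀ {k n} → VKK k n → VKK k n → Bool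
EHKK (x i j) (x i' j') =
  (eqFin i i' ∧ not (eqFin j j')) ∨ (nextLayer i i' ∧ (toℕ j ≤ᵇ toℕ j'))
EHKK (x i j) (y i')    = eqFin i i'
EHKK _       _         = false

QHKK : ℕ → ℕ → Graph
QHKK k n = record { V = VKK k n ; adj = symm EHKK }

EAKK : ∀ {k n} → VA k n → VA k n → Bool
EAKK (x i j) (x i' j') =
  (eqFin i i' ∧ not (eqFin j j')) ∨ (nextLayer i i' ∧ not (eqFin j j'))
EAKK (x i j) (y i')    = eqFin i i'
EAKK (z i _) (x i' j)  = eqFin i i' ∨ nextLayer i i'
EAKK _       _         = false

QAKK : ℕ → ℕ → Graph
QAKK k n = record { V = VA k n ; adj = symm EAKK }

module Submission where

-- In every rank-decomposition some tree edge e is balanced: each side of e contains at least a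
-- third of the vertices x^i_j of the clique layers (walk along the tree towards the heavier
-- side; the light side grows at every step, so the walk stops at such an edge). If n clique
-- layers meet both sides of e, these pairwise non-adjacent cliques give an identity submatrix
-- of the cut. Otherwise one clique layer lies entirely on each side, and two such layers can
-- be chosen at most 2n layers apart. Every column changes side between them and there are
-- more than 2n² columns, so more than n columns change side between the same two consecutive
-- layers; the matching, anti-matching or half-graph joining these layers has rank at least n
-- on those columns.

open import Defs
open import Algebra.Bundles using (CommutativeRing)
import Algebra.Properties.Semiring.Sum
open import Data.Bool using (Bool; true; false; _∧_; _∨_; not; _xor_; if_then_else_)
open import Data.Bool.Properties
  using ( xor-∧-commutativeRing; xor-identityʳ; T-≡; ¬-not; not-injective; not-involutive
        ; ∧-comm; ∧-zeroʳ; ∧-identityʳ; ∧-conicalˡ; ∧-conicalʳ; ∨-comm; ∨-identityʳ; ∨-zeroʳ )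
  renaming (_≟_ to _≟ᴮ_)
open import Data.Empty using (⊥; ⊥-elim)
open import Data.Fin using (Fin; zero; suc; toℕ; inject₁)
open import Data.Fin.Properties using (toℕ-injective; toℕ<n; toℕ-inject₁) renaming (_≟_ to _≟ᶠ_)
open import Data.List using (List; []; _∷_; _++_; [_])
open import Data.List.Membership.Propositional using (_∈_)
open import Data.List.Relation.Unary.All using ([])
open import Data.List.Relation.Unary.All.Properties using (¬Any⇒All¬)
open import Data.List.Relation.Unary.AllPairs using ([]; _∷_)
open import Data.List.Relation.Unary.Any using (here; there)
open import Data.List.Relation.Unary.Unique.Propositional using (Unique)
open import Data.Nat
  using (ℕ; zero; suc; _+_; _*_; _∸_; _≤_; _<_; _≡ᵇ_; _≤ᵇ_; _≤?_; _<?_; z≤n; s≤s; s≤s⁻¹; >-nonZero)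
open import Data.Nat.Induction using (<-wellFounded)
open import Data.Nat.Properties
open import Algebra.Properties.CommutativeSemigroup +-commutativeSemigroup using (interchange)
open import Algebra.Properties.CommutativeSemigroup *-commutativeSemigroup using (x∙yz≈y∙xz)
open import Data.Product using (Σ; ∃; ∃₂; _×_; _,_; proj₁; proj₂)
import Data.Product as Product
open import Data.Sum using (_⊎_; inj₁; inj₂; [_,_]′)
import Data.Sum as Sum
open import Data.Unit using (tt)
open import Function using (_∘_; id; const; Equivalence)
open import Induction.WellFounded using (Acc; acc)
open import Relation.Binary.Definitions using (tri<; tri≈; tri>)
open import Relation.Binary.PropositionalEquality hiding ([_])
open import Relation.Nullary using (¬_; Dec; yes; no; contradiction)
open import Relation.Nullary.Decidable using (isYes; _⊎-dec_)

≡ᵇ-refl : ∀ n → (n ≡ᵇ n) ≡ true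
≡ᵇ-refl n = Equivalence.to T-≡ (≡⇒≡ᵇ n n refl)

≡ᵇ-≢ : ∀ {m n} → m ≢ n → (m ≡ᵇ n) ≡ false
≡ᵇ-≢ {m} {n} m≢n with m ≡ᵇ n in eq
... | false = refl
... | true  = contradiction (≡ᵇ⇒≡ m n (Equivalence.from T-≡ eq)) m≢n

eqFin-refl : ∀ {t} (a : Fin t) → eqFin a a ≡ true
eqFin-refl a = ≡ᵇ-refl (toℕ a)

eqFin-≢ : ∀ {t} {a b : Fin t} → a ≢ b → eqFin a b ≡ false
eqFin-≢ a≢b = ≡ᵇ-≢ (a≢b ∘ toℕ-injective)

eqFin⇒≡ : ∀ {t} {a b : Fin t} → eqFin a b ≡ true → a ≡ b
eqFin⇒≡ {a = a} {b} e = toℕ-injective (≡ᵇ⇒≡ (toℕ a) (toℕ b) (Equivalence.from T-≡ e))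

not-eqFin : ∀ {t} {a b : Fin t} → not (eqFin a b) ≡ true → a ≢ b
not-eqFin {a = a} e refl = contradiction (trans (sym e) (cong not (eqFin-refl a))) λ ()

∨-introˡ : ∀ {a} b → a ≡ true → (a ∨ b) ≡ true
∨-introˡ b refl = refl

∨-introʳ : ∀ a {b} → b ≡ true → (a ∨ b) ≡ true
∨-introʳ a refl = ∨-zeroʳ a

∧-false : ∀ {a b} → ¬ (a ≡ true × b ≡ true) → (a ∧ b) ≡ false
∧-false {false} _ = refl
∧-false {true} {false} _ = refl
∧-false {true} {true} ¬both = contradiction (refl , refl) ¬both

_⊆_ : {A : Set} → (A → Bool) → (A → Bool) → Set
p ⊆ q = ∀ {a} → p a ≡ true → q a ≡ true

bit : Bool → ℕ
bit b = if b then 1 else 0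

bit-mono : ∀ {a b} → (a ≡ true → b ≡ true) → bit a ≤ bit b
bit-mono {false} _   = z≤n
bit-mono {true} a⇒b rewrite a⇒b refl = ≤-refl

without : ∀ {t} → (Fin t → Bool) → Fin t → Fin t → Bool
without p a b = p b ∧ not (eqFin b a)

without-true : ∀ {t} {p : Fin t → Bool} {a b} → p b ≡ true → b ≢ a → without p a b ≡ true
without-true pb b≢a rewrite pb | eqFin-≢ b≢a = refl

without-elim : ∀ {t} {p : Fin t → Bool} {a b} → without p a b ≡ true → p b ≡ true × b ≢ a
without-elim e = ∧-conicalˡ _ _ e , not-eqFin (∧-conicalʳ _ _ e)

count-cong : ∀ {t} {p q : Fin t → Bool} → (∀ i → p i ≡ q i) → count p ≡ count q
count-cong {zero}  _   = refl
count-cong {suc t} p≗q = cong₂ _+_ (cong bit (p≗q zero)) (count-cong (p≗q ∘ suc))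

count-≤ : ∀ {t} (p : Fin t → Bool) → count p ≤ t
count-≤ {zero}  p = z≤n
count-≤ {suc t} p with p zero
... | true  = s≤s (count-≤ (p ∘ suc))
... | false = m≤n⇒m≤1+n (count-≤ (p ∘ suc))

count-mono : ∀ {t} {p q : Fin t → Bool} → p ⊆ q → count p ≤ count q
count-mono {zero}  _   = z≤n
count-mono {suc t} {p} {q} p⊆q = +-mono-≤ (bit-mono p⊆q) (count-mono {p = p ∘ suc} {q ∘ suc} p⊆q)

count-< : ∀ {t} {p q : Fin t → Bool} → p ⊆ q → ∀ v → p v ≡ false → q v ≡ true → count p < count q
count-< {suc t} {p} {q} p⊆q zero pv qv rewrite pv | qv =
  s≤s (count-mono {p = p ∘ suc} {q ∘ suc} p⊆q)
count-< {suc t} {p} {q} p⊆q (suc v) pv qv =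
  +-mono-≤-< (bit-mono p⊆q) (count-< {p = p ∘ suc} {q ∘ suc} p⊆q v pv qv)

count-without : ∀ {t} (p : Fin t → Bool) {a} → p a ≡ true → count p ≡ suc (count (without p a))
count-without {suc t} p {zero} pa rewrite pa =
  cong suc (count-cong λ i → sym (∧-identityʳ (p (suc i))))
count-without {suc t} p {suc a} pa with p zero
... | true  = cong suc (count-without (p ∘ suc) pa)
... | false = count-without (p ∘ suc) pa

count-pick : ∀ {t} (p : Fin t → Bool) {k} → count p ≡ suc k → ∃ λ a → p a ≡ true
count-pick {zero}  p ()
count-pick {suc t} p c with p zero in p0
... | true  = zero , p0
... | false = Product.map suc id (count-pick (p ∘ suc) c)

count≤1⇒unique : ∀ {t} (p : Fin t → Bool) → count p ≤ 1 →
                 ∀ {a b} → p a ≡ true → p b ≡ true → a ≡ b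
count≤1⇒unique p c≤1 {a} {b} pa pb with b ≟ᶠ a
... | yes b≡a = sym b≡a
... | no  b≢a = contradiction c≤1 (<⇒≱ (subst (1 <_) (sym count≡2+) (s≤s (s≤s z≤n))))
  where
  count≡2+ : count p ≡ suc (suc (count (without (without p a) b)))
  count≡2+ = trans (count-without p pa) (cong suc (count-without (without p a) (without-true {p = p} pb b≢a)))

count≡2⇒pair : ∀ {t} (p : Fin t → Bool) → count p ≡ 2 →
               ∃₂ λ w₁ w₂ → p w₁ ≡ true × p w₂ ≡ true × (∀ {b} → p b ≡ true → b ≡ w₁ ⊎ b ≡ w₂)
count≡2⇒pair p c≡2 with count-pick p c≡2
... | w₁ , pw₁ with count-pick (without p w₁) (suc-injective (trans (sym (count-without p pw₁)) c≡2))
...   | w₂ , pw₂ = w₁ , w₂ , pw₁ , proj₁ (without-elim {p = p} pw₂) , either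
  where
  rest≡1 : count (without p w₁) ≡ 1
  rest≡1 = suc-injective (trans (sym (count-without p pw₁)) c≡2)
  either : ∀ {b} → p b ≡ true → b ≡ w₁ ⊎ b ≡ w₂
  either {b} pb with b ≟ᶠ w₁
  ... | yes b≡w₁ = inj₁ b≡w₁
  ... | no  b≢w₁ =
    inj₂ (count≤1⇒unique (without p w₁) (≤-reflexive rest≡1) (without-true {p = p} pb b≢w₁) pw₂)

module _ {V : Set} where

  _⊆₂_ : (V → V → Bool) → (V → V → Bool) → Set
  E ⊆₂ F = ∀ {a b} → E a b ≡ true → F a b ≡ true

  Reach-mono : ∀ {E F} → E ⊆₂ F → ∀ {p q} → Reach E p q → Reach F p q
  Reach-mono E⊆F here       = here
  Reach-mono E⊆F (step e r) = step (E⊆F e) (Reach-mono E⊆F r)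

  Reach-trans : ∀ {E : V → V → Bool} {p q r} → Reach E p q → Reach E q r → Reach E p r
  Reach-trans here        r₂ = r₂
  Reach-trans (step e r₁) r₂ = step e (Reach-trans r₁ r₂)

  Reach-sym : ∀ {E} → (∀ a b → E a b ≡ E b a) → ∀ {p q} → Reach E p q → Reach E q p
  Reach-sym E-sym here               = here
  Reach-sym E-sym (step {a} {b} e r) = Reach-trans (Reach-sym E-sym r) (step (trans (E-sym b a) e) here)

  data Path (E : V → V → Bool) : V → List V → V → Set where
    []  : ∀ {p} → Path E p [] p
    _∷_ : ∀ {p b l q} → E p b ≡ true → Path E b l q → Path E p (b ∷ l) q

  Path⇒ConsecAdj : ∀ {E F p l q w} → E ⊆₂ F → Path E p l q → F q w ≡ true →
                   ConsecAdj F (p ∷ l ++ [ w ])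
  Path⇒ConsecAdj E⊆F []      qw = qw , tt
  Path⇒ConsecAdj E⊆F (e ∷ P) qw = E⊆F e , Path⇒ConsecAdj E⊆F P qw

isInj₁ : {P Q : Set} → P ⊎ Q → Bool
isInj₁ = [ const true , const false ]′

isInj₁-true : {P Q : Set} (s : P ⊎ Q) → isInj₁ s ≡ true → P
isInj₁-true (inj₁ p) _ = p

isInj₁-false : {P Q : Set} (s : P ⊎ Q) → isInj₁ s ≡ false → Q
isInj₁-false (inj₂ q) _ = q

-- Trees: the two sides of an edge

module Tree {t : ℕ} (tree : SimpleGraphOn t) (isTree : IsTree tree) where

  open SimpleGraphOn tree using () renaming (adj to E; sym to E-sym; irrefl to E-irrefl)
  open IsTree isTree
  open import Data.List.Membership.DecPropositional (_≟ᶠ_ {t}) using (_∈?_)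

  E-≢ : ∀ {a b} → E a b ≡ true → a ≢ b
  E-≢ {a} ab refl = contradiction (trans (sym ab) (E-irrefl a)) λ ()

  E∖ : Fin t → Fin t → Fin t → Fin t → Bool
  E∖ = deleteEdge E

  ∖⊆ : ∀ {u v} → E∖ u v ⊆₂ E
  ∖⊆ e = ∧-conicalˡ _ _ e

  ∖-keep : ∀ {u v a b} → E a b ≡ true → ¬ (a ≡ u × b ≡ v) → ¬ (a ≡ v × b ≡ u) → E∖ u v a b ≡ true
  ∖-keep ab ¬uv ¬vu
    rewrite ab | ∧-false (¬uv ∘ Product.map eqFin⇒≡ eqFin⇒≡)
               | ∧-false (¬vu ∘ Product.map eqFin⇒≡ eqFin⇒≡) = refl

  ∖-self : ∀ u v → E∖ u v u v ≡ false
  ∖-self u v rewrite eqFin-refl u | eqFin-refl v = ∧-zeroʳ (E u v)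

  ∖-swap : ∀ {u v} → E∖ u v ⊆₂ E∖ v u
  ∖-swap {u} {v} {a} {b} = subst (_≡ true)
    (cong (λ c → E a b ∧ not c) (∨-comm (eqFin a u ∧ eqFin b v) (eqFin a v ∧ eqFin b u)))

  ∖-sym : ∀ u v a b → E∖ u v a b ≡ E∖ u v b a
  ∖-sym u v a b = cong₂ (λ c d → c ∧ not d) (E-sym a b)
    (trans (∨-comm (eqFin a u ∧ eqFin b v) _)
           (cong₂ _∨_ (∧-comm (eqFin a v) (eqFin b u)) (∧-comm (eqFin a u) (eqFin b v))))

  reach-around : ∀ u v {p a} → Reach E p a →
                 Reach (E∖ u v) p a ⊎ Reach (E∖ u v) u a ⊎ Reach (E∖ u v) v a
  reach-around u v here = inj₁ here
  reach-around u v (step {b = b} pb r) with reach-around u v r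
  ... | inj₂ r′ = inj₂ r′
  ... | inj₁ r′ with b ≟ᶠ u | b ≟ᶠ v
  ...   | yes refl | _        = inj₂ (inj₁ r′)
  ...   | no  _    | yes refl = inj₂ (inj₂ r′)
  ...   | no  b≢u  | no  b≢v  = inj₁ (step (∖-keep pb (b≢v ∘ proj₂) (b≢u ∘ proj₂)) r′)

  reach-from-edge : ∀ u v {a} → Reach E u a → Reach (E∖ u v) u a ⊎ Reach (E∖ u v) v a
  reach-from-edge u v r with reach-around u v r
  ... | inj₁ r′ = inj₁ r′
  ... | inj₂ r′ = r′

  suffix : ∀ {F : Fin t → Fin t → Bool} {b l q p} → Path F b l q → Unique (b ∷ l) → p ∈ b ∷ l →
           ∃ λ l′ → Path F p l′ q × Unique (p ∷ l′)
  suffix P       u       (here refl) = _ , P , u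
  suffix (e ∷ P) (_ ∷ u) (there p∈)  = suffix P u p∈

  simple-path : ∀ {F : Fin t → Fin t → Bool} {p q} → Reach F p q →
                ∃ λ l → Path F p l q × Unique (p ∷ l)
  simple-path here = [] , [] , [] ∷ []
  simple-path {p = p} (step {b = b} e r) with simple-path r
  ... | l , P , u with p ∈? b ∷ l
  ...   | yes p∈ = suffix P u p∈
  ...   | no  p∉ = b ∷ l , e ∷ P , ¬Any⇒All¬ (b ∷ l) p∉ ∷ u

  no-bypass : ∀ {u v} → E u v ≡ true → ¬ Reach (E∖ u v) u v
  no-bypass {u} {v} uv r with simple-path r
  ... | []         , []        , _      = E-≢ uv refl
  ... | _ ∷ []     , e ∷ []    , _      = contradiction (trans (sym e) (∖-self u v)) λ ()
  ... | b ∷ c ∷ l , P , unique =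
    acyclic u (b ∷ c ∷ l) (s≤s (s≤s z≤n) , unique , Path⇒ConsecAdj ∖⊆ P (trans (E-sym v u) uv))

  separated : ∀ {u v a} → E u v ≡ true → Reach (E∖ u v) u a → ¬ Reach (E∖ u v) v a
  separated uv ua va = no-bypass uv (Reach-trans ua (Reach-sym (∖-sym _ _) va))

  -- side u v a: a lies in the component of T − uv containing u (meaningful for edges uv only).
  side : Fin t → Fin t → Fin t → Bool
  side u v a = isInj₁ (reach-from-edge u v (connected u a))

  side-true : ∀ {u v a} → side u v a ≡ true → Reach (E∖ u v) u a
  side-true {u} {v} {a} = isInj₁-true (reach-from-edge u v (connected u a))

  side-false : ∀ {u v a} → side u v a ≡ false → Reach (E∖ u v) v a
  side-false {u} {v} {a} = isInj₁-false (reach-from-edge u v (connected u a))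

  side≡true : ∀ {u v a} → E u v ≡ true → Reach (E∖ u v) u a → side u v a ≡ true
  side≡true {u} {v} {a} uv ua with side u v a in eq
  ... | true  = refl
  ... | false = contradiction (side-false eq) (separated uv ua)

  side≡false : ∀ {u v a} → E u v ≡ true → Reach (E∖ u v) v a → side u v a ≡ false
  side≡false {u} {v} {a} uv va with side u v a in eq
  ... | false = refl
  ... | true  = contradiction va (separated uv (side-true eq))

  side-swap : ∀ {u v} → E u v ≡ true → ∀ a → side v u a ≡ not (side u v a)
  side-swap {u} {v} uv a with side u v a in eq
  ... | true  = side≡false vu (Reach-mono ∖-swap (side-true eq))
    where vu = trans (E-sym v u) uv
  ... | false = side≡true vu (Reach-mono ∖-swap (side-false eq))
    where vu = trans (E-sym v u) uv

  avoiding : Fin t → (Fin t → Fin t → Bool) → Fin t → Fin t → Bool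
  avoiding v F a b = F a b ∧ not (eqFin a v) ∧ not (eqFin b v)

  avoiding-intro : ∀ {F v a b} → F a b ≡ true → a ≢ v → b ≢ v → avoiding v F a b ≡ true
  avoiding-intro ab a≢v b≢v rewrite ab | eqFin-≢ a≢v | eqFin-≢ b≢v = refl

  avoiding-elim : ∀ {F v a b} → avoiding v F a b ≡ true → F a b ≡ true × a ≢ v × b ≢ v
  avoiding-elim {F} {v} {a} {b} e =
    ∧-conicalˡ (F a b) _ e , not-eqFin (∧-conicalˡ _ _ rest) , not-eqFin (∧-conicalʳ _ _ rest)
    where rest = ∧-conicalʳ (F a b) _ e

  avoiding⊆∖ : ∀ {F v w} → F ⊆₂ E → avoiding v F ⊆₂ E∖ w v
  avoiding⊆∖ {F} F⊆E e with avoiding-elim {F} e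
  ... | ab , a≢v , b≢v = ∖-keep (F⊆E ab) (b≢v ∘ proj₂) (a≢v ∘ proj₁)

  avoiding-source : ∀ {F v p a} → Reach (avoiding v F) p a → a ≢ v → p ≢ v
  avoiding-source           here       a≢v = a≢v
  avoiding-source {F} {v} (step e _) _   = proj₁ (proj₂ (avoiding-elim {F} {v} e))

  reach-avoiding : ∀ {F v p a} → Reach F p a → ¬ Reach F p v → Reach (avoiding v F) p a
  reach-avoiding               here       _   = here
  reach-avoiding {F} {v} (step e r) ¬pv =
    step (avoiding-intro {F} {v} e (λ { refl → ¬pv here }) (λ { refl → ¬pv (step e here) }))
         (reach-avoiding r (¬pv ∘ step e))

  last-exit : ∀ {F v p a} → a ≢ v → Reach F p a →
              Reach (avoiding v F) p a ⊎ ∃ λ w → F v w ≡ true × Reach (avoiding v F) w a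
  last-exit a≢v here = inj₁ here
  last-exit {F} {v} a≢v (step {a = p} {b} e r) with last-exit {F} a≢v r
  ... | inj₂ exit = inj₂ exit
  ... | inj₁ r′ with p ≟ᶠ v
  ...   | yes refl = inj₂ (b , e , r′)
  ...   | no  p≢v  = inj₁ (step (avoiding-intro {F} e p≢v (avoiding-source {F} r′ a≢v)) r′)

  leaf-side : ∀ {v u a} → IsLeaf tree v → E v u ≡ true → Reach (E∖ v u) v a → a ≡ v
  leaf-side leaf vu here = refl
  leaf-side {v} {u} leaf vu (step e r) with count≤1⇒unique (E v) leaf (∖⊆ e) vu
  ... | refl = contradiction (trans (sym e) (∖-self v u)) λ ()

  branches : ∀ {u v} → degree tree v ≡ 3 → E v u ≡ true →
             ∃₂ λ w₁ w₂ → (E v w₁ ≡ true × w₁ ≢ u) × (E v w₂ ≡ true × w₂ ≢ u) ×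
               (∀ {a} → a ≢ v → side v u a ≡ true → (side w₁ v a ∨ side w₂ v a) ≡ true)
  branches {u} {v} deg₃ vu
    with count≡2⇒pair (without (E v) u) (suc-injective (trans (sym (count-without (E v) vu)) deg₃))
  ... | w₁ , w₂ , vw₁ , vw₂ , others =
    w₁ , w₂ , without-elim {p = E v} vw₁ , without-elim {p = E v} vw₂ , covered
    where
    enter : ∀ {w a} → E v w ≡ true → Reach (avoiding v (E∖ v u)) w a → side w v a ≡ true
    enter vw wa = side≡true (trans (E-sym _ v) vw) (Reach-mono (avoiding⊆∖ ∖⊆) wa)
    covered : ∀ {a} → a ≢ v → side v u a ≡ true → (side w₁ v a ∨ side w₂ v a) ≡ true
    covered a≢v vua with last-exit a≢v (side-true vua)
    ... | inj₁ r = contradiction refl (avoiding-source {E∖ v u} r a≢v)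
    ... | inj₂ (w , vw , wa) with others (without-true {p = E v} (∖⊆ vw) λ { refl → ∖-self-true vw })
      where
      ∖-self-true : E∖ v u v u ≢ true
      ∖-self-true e = contradiction (trans (sym e) (∖-self v u)) λ ()
    ...   | inj₁ refl = ∨-introˡ _ (enter (∖⊆ vw) wa)
    ...   | inj₂ refl = ∨-introʳ _ (enter (∖⊆ vw) wa)

  side-⊂ : ∀ {u v w} → E u v ≡ true → E v w ≡ true → w ≢ u → count (side u v) < count (side v w)
  side-⊂ {u} {v} {w} uv vw w≢u = count-< grow v (side≡false uv here) (side≡true vw here)
    where
    vu : E∖ v w v u ≡ true
    vu = ∖-keep (trans (E-sym v u) uv) (w≢u ∘ sym ∘ proj₂) (E-≢ uv ∘ proj₂)
    grow : side u v ⊆ side v w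
    grow ua = side≡true vw
      (step vu (Reach-mono (∖-swap ∘ avoiding⊆∖ ∖⊆) (reach-avoiding (side-true ua) (no-bypass uv))))

-- A balanced edge in every rank-decomposition

AtMostOne : {A : Set} → (A → Bool) → Set
AtMostOne p = ∀ {a b} → p a ≡ true → p b ≡ true → a ≡ b

three-light-parts : ∀ {W a b c} → W ≤ a + (b + c) → 3 * a < W → 3 * b < W → 3 * c < W → ⊥
three-light-parts {W} {a} {b} {c} W≤ a< b< c< = <-irrefl refl (begin-strict
  3 * W                    ≤⟨ *-monoʳ-≤ 3 W≤ ⟩
  3 * (a + (b + c))        ≡⟨ *-distribˡ-+ 3 a (b + c) ⟩
  3 * a + 3 * (b + c)      ≡⟨ cong (3 * a +_) (*-distribˡ-+ 3 b c) ⟩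
  3 * a + (3 * b + 3 * c)  <⟨ +-mono-< a< (+-mono-< b< c<) ⟩
  W + (W + W)              ≡⟨ cong (λ k → W + (W + k)) (sym (+-identityʳ W)) ⟩
  3 * W                    ∎)
  where open ≤-Reasoning

module Sides {G : Graph} (D : RankDecomposition G) where

  open RankDecomposition D
  open Tree tree isTree
  open IsTree isTree using (connected)
  open SimpleGraphOn tree using () renaming (adj to E; sym to E-sym)

  leafOf : Graph.V G → Fin t
  leafOf g = proj₁ (δ-surj g)

  leafOf-leaf : ∀ g → IsLeaf tree (leafOf g)
  leafOf-leaf g = proj₁ (proj₂ (δ-surj g))

  δ-leafOf : ∀ g → δ (leafOf g) ≡ g
  δ-leafOf g = proj₂ (proj₂ (δ-surj g))

  σ : Fin t → Fin t → Graph.V G → Bool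
  σ u v g = side u v (leafOf g)

  σ-sound : ∀ {u v g} → σ u v g ≡ true → Side D u v g
  σ-sound {g = g} e = leafOf g , leafOf-leaf g , side-true e , δ-leafOf g

  σ-complete : ∀ {u v g} → E u v ≡ true → σ u v g ≡ false → ¬ Side D u v g
  σ-complete {g = g} uv e (a , leaf , ua , δa)
    with δ-inj a (leafOf g) leaf (leafOf-leaf g) (trans δa (sym (δ-leafOf g)))
  ... | refl = separated uv ua (side-false e)

  σ-swap : ∀ {u v} → E u v ≡ true → ∀ g → σ v u g ≡ not (σ u v g)
  σ-swap uv g = side-swap uv (leafOf g)

  module _ (μ : (Graph.V G → Bool) → ℕ) (W : ℕ)
           (μ-mono  : ∀ {p q} → p ⊆ q → μ p ≤ μ q)
           (μ-∨     : ∀ p q → μ (λ g → p g ∨ q g) ≤ μ p + μ q)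
           (μ-compl : ∀ p → W ≤ μ p + μ (not ∘ p))
           (μ-small : ∀ {p} → AtMostOne p → 3 * μ p < W) where

    Light : Fin t → Fin t → Set
    Light u v = 3 * μ (σ u v) < W

    BalancedEdge : Set
    BalancedEdge = ∃₂ λ u v → E u v ≡ true × W ≤ 3 * μ (σ u v) × W ≤ 3 * μ (σ v u)

    both-sides : ∀ {u v} → E u v ≡ true → W ≤ μ (σ u v) + μ (σ v u)
    both-sides {u} {v} uv =
      ≤-trans (μ-compl (σ u v)) (+-monoʳ-≤ (μ (σ u v)) (μ-mono λ {g} e → trans (σ-swap uv g) e))

    light⇒¬leaf : ∀ {u v} → E u v ≡ true → Light u v → ¬ IsLeaf tree v
    light⇒¬leaf {u} {v} uv light leaf =
      three-light-parts {a = μ (σ u v)} {b = μ (σ v u)} {0} W≤ light (μ-small single) (≤-<-trans z≤n light)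
      where
      vu = trans (E-sym v u) uv
      single : AtMostOne (σ v u)
      single {g} {h} vg vh = begin
        g               ≡⟨ sym (δ-leafOf g) ⟩
        δ (leafOf g)    ≡⟨ cong δ (leaf-side leaf vu (side-true vg)) ⟩
        δ v             ≡⟨ cong δ (sym (leaf-side leaf vu (side-true vh))) ⟩
        δ (leafOf h)    ≡⟨ δ-leafOf h ⟩
        h               ∎
        where open ≡-Reasoning
      W≤ : W ≤ μ (σ u v) + (μ (σ v u) + 0)
      W≤ = subst (λ k → W ≤ μ (σ u v) + k) (sym (+-identityʳ _)) (both-sides uv)

    heavy-branch : ∀ {u v} → E u v ≡ true → Light u v → degree tree v ≡ 3 →
                   ∃ λ w → E v w ≡ true × w ≢ u × W ≤ 3 * μ (σ w v)
    heavy-branch {u} {v} uv light deg₃ with branches deg₃ (trans (E-sym v u) uv)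
    ... | w₁ , w₂ , (vw₁ , w₁≢u) , (vw₂ , w₂≢u) , covered
      with 3 * μ (σ w₁ v) <? W | 3 * μ (σ w₂ v) <? W
    ...   | no  heavy₁ | _          = w₁ , vw₁ , w₁≢u , ≮⇒≥ heavy₁
    ...   | yes _      | no heavy₂  = w₂ , vw₂ , w₂≢u , ≮⇒≥ heavy₂
    ...   | yes light₁ | yes light₂ =
      ⊥-elim (three-light-parts {a = μ (σ u v)} {b = μ (σ w₁ v)} {μ (σ w₂ v)} W≤ light light₁ light₂)
      where
      leaf≢v : ∀ g → leafOf g ≢ v
      leaf≢v g eq =
        <⇒≱ (s≤s (s≤s z≤n)) (subst (_≤ 1) deg₃ (subst (λ a → degree tree a ≤ 1) eq (leafOf-leaf g)))
      W≤ : W ≤ μ (σ u v) + (μ (σ w₁ v) + μ (σ w₂ v))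
      W≤ = ≤-trans (both-sides uv)
             (+-monoʳ-≤ (μ (σ u v)) (≤-trans (μ-mono (covered (leaf≢v _))) (μ-∨ (σ w₁ v) (σ w₂ v))))

    advance : ∀ {u v} → E u v ≡ true → Light u v →
              BalancedEdge ⊎ ∃ λ w → E v w ≡ true × Light v w × count (side u v) < count (side v w)
    advance {u} {v} uv light with cubic v
    ... | inj₁ leaf = ⊥-elim (light⇒¬leaf uv light leaf)
    ... | inj₂ deg₃ with heavy-branch uv light deg₃
    ...   | w , vw , w≢u , heavy with 3 * μ (σ v w) <? W
    ...     | yes light′ = inj₂ (w , vw , light′ , side-⊂ uv vw w≢u)
    ...     | no  heavy′ = inj₁ (v , w , vw , ≮⇒≥ heavy′ , heavy)

    -- Each step of the walk strictly enlarges the light side, so it stops within t steps.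
    walk : ∀ fuel {u v} → t ≤ fuel + count (side u v) → E u v ≡ true → Light u v → BalancedEdge
    walk fuel bound uv light with advance uv light
    ... | inj₁ balanced = balanced
    ... | inj₂ (w , vw , light′ , grows) with fuel
    ...   | zero      = ⊥-elim (<-irrefl refl (≤-<-trans bound (<-≤-trans grows (count-≤ _))))
    ...   | suc fuel′ = walk fuel′ bound′ vw light′
      where
      bound′ = ≤-trans bound (≤-trans (≤-reflexive (sym (+-suc fuel′ _))) (+-monoʳ-≤ fuel′ grows))

    balanced-edge : ∀ {g₀ g₁} → g₀ ≢ g₁ → BalancedEdge
    balanced-edge {g₀} {g₁} g₀≢g₁ = start leaves≢ (connected (leafOf g₀) (leafOf g₁))
      where
      leaves≢ : leafOf g₀ ≢ leafOf g₁
      leaves≢ eq = g₀≢g₁ (trans (sym (δ-leafOf g₀)) (trans (cong δ eq) (δ-leafOf g₁)))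
      start : ∀ {a b} → a ≢ b → Reach E a b → BalancedEdge
      start a≢b here = contradiction refl a≢b
      start _ (step {a} {c} ac _) with 3 * μ (σ a c) <? W | 3 * μ (σ c a) <? W
      ... | yes light | _         = walk t (m≤m+n t _) ac light
      ... | no  _     | yes light = walk t (m≤m+n t _) (trans (E-sym c a) ac) light
      ... | no  h₁    | no  h₂    = a , c , ac , ≮⇒≥ h₁ , ≮⇒≥ h₂

∑< : ℕ → (ℕ → ℕ) → ℕ
∑< zero    f = 0
∑< (suc k) f = ∑< k f + f k

syntax ∑< k (λ i → e) = ∑[ i < k ] e

#< : ℕ → (ℕ → Bool) → ℕ
#< k q = ∑[ i < k ] bit (q i)

syntax #< k (λ i → e) = #[ i < k ] e

∑-mono : ∀ k {f g : ℕ → ℕ} → (∀ {i} → i < k → f i ≤ g i) → ∑< k f ≤ ∑< k g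
∑-mono zero    _   = z≤n
∑-mono (suc k) f≤g = +-mono-≤ (∑-mono k (λ i<k → f≤g (m<n⇒m<1+n i<k))) (f≤g ≤-refl)

∑-cong : ∀ k {f g : ℕ → ℕ} → (∀ i → f i ≡ g i) → ∑< k f ≡ ∑< k g
∑-cong zero    _   = refl
∑-cong (suc k) f≗g = cong₂ _+_ (∑-cong k f≗g) (f≗g k)

∑-+ : ∀ k (f g : ℕ → ℕ) → ∑[ i < k ] (f i + g i) ≡ ∑< k f + ∑< k g
∑-+ zero    f g = refl
∑-+ (suc k) f g rewrite ∑-+ k f g = interchange (∑< k f) (∑< k g) (f k) (g k)

∑-const : ∀ k c → ∑[ i < k ] c ≡ k * c
∑-const zero    c = refl
∑-const (suc k) c rewrite ∑-const k c = +-comm (k * c) c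

∑-scale : ∀ k c (f : ℕ → ℕ) → ∑[ i < k ] (c * f i) ≡ c * ∑< k f
∑-scale zero    c f = sym (*-zeroʳ c)
∑-scale (suc k) c f rewrite ∑-scale k c f = sym (*-distribˡ-+ c (∑< k f) (f k))

∑-comm : ∀ a b (f : ℕ → ℕ → ℕ) → ∑[ i < a ] ∑[ j < b ] f i j ≡ ∑[ j < b ] ∑[ i < a ] f i j
∑-comm zero    b f = sym (trans (∑-const b 0) (*-zeroʳ b))
∑-comm (suc a) b f rewrite ∑-comm a b f = sym (∑-+ b (λ j → ∑[ i < a ] f i j) (f a))

∑-pigeonhole : ∀ k n (f : ℕ → ℕ) → k * n < ∑< k f → ∃ λ i → i < k × n < f i
∑-pigeonhole k n f k*n< with anyUpTo? (λ i → n <? f i) k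
... | yes found = found
... | no  none  = contradiction k*n< (≤⇒≯ (begin
  ∑< k f          ≤⟨ ∑-mono k (λ i<k → ≮⇒≥ (λ n<fi → none (_ , i<k , n<fi))) ⟩
  ∑[ i < k ] n    ≡⟨ ∑-const k n ⟩
  k * n           ∎))
  where open ≤-Reasoning

#-≤ : ∀ k q → #< k q ≤ k
#-≤ k q = ≤-trans (∑-mono k (λ _ → bit≤1 (q _))) (≤-reflexive (trans (∑-const k 1) (*-identityʳ k)))
  where
  bit≤1 : ∀ b → bit b ≤ 1
  bit≤1 true  = ≤-refl
  bit≤1 false = z≤n

#-mono : ∀ k {p q : ℕ → Bool} → (∀ {i} → i < k → p i ≡ true → q i ≡ true) → #< k p ≤ #< k q
#-mono k p⇒q = ∑-mono k (λ i<k → bit-mono (p⇒q i<k))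

#-∨ : ∀ k (p q : ℕ → Bool) → #[ i < k ] (p i ∨ q i) ≤ #< k p + #< k q
#-∨ k p q = ≤-trans (∑-mono k (λ _ → bit-∨ (p _) (q _))) (≤-reflexive (∑-+ k _ _))
  where
  bit-∨ : ∀ a b → bit (a ∨ b) ≤ bit a + bit b
  bit-∨ true  b = s≤s z≤n
  bit-∨ false b = ≤-refl

#-compl : ∀ k (q : ℕ → Bool) → #< k q + #[ i < k ] not (q i) ≡ k
#-compl k q = begin
  #< k q + #[ i < k ] not (q i)       ≡⟨ ∑-+ k _ _ ⟨
  ∑[ i < k ] (bit (q i) + bit (not (q i)))  ≡⟨ ∑-cong k (λ i → one (q i)) ⟩
  ∑[ i < k ] 1                        ≡⟨ trans (∑-const k 1) (*-identityʳ k) ⟩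
  k                                   ∎
  where
  open ≡-Reasoning
  one : ∀ b → bit b + bit (not b) ≡ 1
  one true  = refl
  one false = refl

#-none : ∀ k {q : ℕ → Bool} → (∀ {i} → i < k → q i ≡ false) → #< k q ≡ 0
#-none zero    _    = refl
#-none (suc k) none rewrite #-none k (λ i<k → none (m<n⇒m<1+n i<k)) | none ≤-refl = refl

#-pos : ∀ k {q : ℕ → Bool} {i} → i < k → q i ≡ true → 1 ≤ #< k q
#-pos (suc k) {q} {i} i<1+k qi with m<1+n⇒m<n∨m≡n i<1+k
... | inj₁ i<k  = ≤-trans (#-pos k i<k qi) (m≤m+n _ _)
... | inj₂ refl rewrite qi = m≤n+m 1 _

#-≤1 : ∀ k {q : ℕ → Bool} → (∀ {i j} → i < k → j < k → q i ≡ true → q j ≡ true → i ≡ j) → #< k q ≤ 1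
#-≤1 zero    _      = z≤n
#-≤1 (suc k) {q} unique with q k in qk
... | false = subst (_≤ 1) (sym (+-identityʳ _))
                (#-≤1 k λ i<k j<k → unique (m<n⇒m<1+n i<k) (m<n⇒m<1+n j<k))
... | true  = ≤-reflexive (cong (_+ 1) (#-none k λ {i} i<k →
                ¬-not λ qi → <-irrefl (unique (m<n⇒m<1+n i<k) ≤-refl qi qk) i<k))

StrictlyDecreasing : ∀ {r} → (Fin r → ℕ) → Set
StrictlyDecreasing g = ∀ {a b} → toℕ a < toℕ b → g b < g a

StrictlyDecreasing⇒injective : ∀ {r} {g : Fin r → ℕ} → StrictlyDecreasing g → ∀ {a b} → g a ≡ g b → a ≡ b
StrictlyDecreasing⇒injective dec {a} {b} ga≡gb with <-cmp (toℕ a) (toℕ b)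
... | tri< a<b _ _ = contradiction (sym ga≡gb) (<⇒≢ (dec a<b))
... | tri≈ _ a≡b _ = toℕ-injective a≡b
... | tri> _ _ b<a = contradiction ga≡gb (<⇒≢ (dec b<a))

select : ∀ k q {r} → r ≤ #< k q →
         Σ (Fin r → ℕ) λ g → StrictlyDecreasing g × (∀ a → g a < k × q (g a) ≡ true)
select k       q {zero}  _  = (λ ()) , (λ { {()} }) , (λ ())
select (suc k) q {suc r} r≤ with q k in qk
... | false = Product.map₂ (Product.map₂ (λ ok a → Product.map₁ m<n⇒m<1+n (ok a)))
                (select k q (subst (suc r ≤_) (+-identityʳ _) r≤))
... | true  with select k q {r} (s≤s⁻¹ (subst (suc r ≤_) (+-comm _ 1) r≤))
...   | g , dec , ok = g′ , dec′ , ok′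
  where
  g′ : Fin (suc r) → ℕ
  g′ zero    = k
  g′ (suc a) = g a
  dec′ : StrictlyDecreasing g′
  dec′ {zero}  {suc b} _         = proj₁ (ok b)
  dec′ {suc a} {suc b} (s≤s a<b) = dec a<b
  ok′ : ∀ a → g′ a < suc k × q (g′ a) ≡ true
  ok′ zero    = ≤-refl , qk
  ok′ (suc a) = m<n⇒m<1+n (proj₁ (ok a)) , proj₂ (ok a)

isYes-true : ∀ {P : Set} (d : Dec P) → isYes d ≡ true → P
isYes-true (yes p) _ = p

isYes-false : ∀ {P : Set} (d : Dec P) → isYes d ≡ false → ¬ P
isYes-false (no ¬p) _ = ¬p

crossing : ∀ (f : ℕ → Bool) D → f 0 ≡ true → f D ≡ false →
           ∃ λ d → d < D × f d ≡ true × f (suc d) ≡ false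
crossing f zero    f0 fD = contradiction (trans (sym f0) fD) λ ()
crossing f (suc D) f0 fD with f D in fd
... | true  = D , ≤-refl , fd , fD
... | false = Product.map₂ (Product.map₁ m<n⇒m<1+n) (crossing f D f0 fd)

-- Balanced two-colourings of a grid

Grid : Set
Grid = ℕ → ℕ → Bool

complement : Grid → Grid
complement s i j = not (s i j)

module GridLemma (n K : ℕ) (3n≤K : 3 * n ≤ K) (n²<K : n * n < K) where

  m : ℕ
  m = 2 * K

  0<m : 0 < m
  0<m = *-monoʳ-< 2 (≤-<-trans z≤n n²<K)

  -- Row r stands for layer r + 1, so the rows 2i are the clique layers; only they are weighed.
  weight : Grid → ℕ
  weight s = ∑[ i < K ] #[ j < m ] s (2 * i) j

  Heavy : Grid → Set
  Heavy s = K * m ≤ 3 * weight s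

  RowIs : Grid → ℕ → Bool → Set
  RowIs s r b = ∀ {j} → j < m → s r j ≡ b

  Mixed : Grid → ℕ → Set
  Mixed s r = (∃ λ j → j < m × s r j ≡ true) × (∃ λ j → j < m × s r j ≡ false)

  MixedRows : Grid → Set
  MixedRows s = Σ (Fin n → ℕ) λ ρ →
    (∀ {k l} → ρ k ≡ ρ l → k ≡ l) × (∀ k → ρ k < K × Mixed s (2 * ρ k))

  Switches : Grid → Set
  Switches s = Σ ℕ λ i → Σ Bool λ b → Σ (Fin (suc n) → ℕ) λ g →
    suc i < m × StrictlyDecreasing g × (∀ k → g k < m × s i (g k) ≡ b × s (suc i) (g k) ≡ not b)

  rowIs? : ∀ s r b → Dec (RowIs s r b)
  rowIs? s r b = allUpTo? (λ j → s r j ≟ᴮ b) m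

  ¬RowIs⇒ : ∀ {s r b} → ¬ RowIs s r b → ∃ λ j → j < m × s r j ≡ not b
  ¬RowIs⇒ {s} {r} {b} ¬all with anyUpTo? (λ j → s r j ≟ᴮ not b) m
  ... | yes found = found
  ... | no  none  =
    contradiction (λ {j} j<m → trans (¬-not λ e → none (j , j<m , e)) (not-involutive b)) ¬all

  hasTrue : Grid → ℕ → Bool
  hasTrue s r = isYes (anyUpTo? (λ j → s r j ≟ᴮ true) m)

  row-≤ : ∀ s r → #[ j < m ] s r j ≤ m * bit (hasTrue s r)
  row-≤ s r with hasTrue s r in has
  ... | true  = subst (#[ j < m ] s r j ≤_) (sym (*-identityʳ m)) (#-≤ m (s r))
  ... | false = subst (_≤ m * 0) (sym (#-none m λ j<m → ¬-not λ e → none (_ , j<m , e))) z≤n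
    where none = isYes-false (anyUpTo? (λ j → s r j ≟ᴮ true) m) has

  weight-≤ : ∀ s → weight s ≤ m * #[ i < K ] hasTrue s (2 * i)
  weight-≤ s = ≤-trans (∑-mono K λ _ → row-≤ s _) (≤-reflexive (∑-scale K m _))

  true-row-or-mixed : ∀ s → Heavy s → (∃ λ a → a < K × RowIs s (2 * a) true) ⊎ MixedRows s
  true-row-or-mixed s heavy with anyUpTo? (λ a → rowIs? s (2 * a) true) K
  ... | yes found = inj₁ found
  ... | no  none with n ≤? #[ i < K ] hasTrue s (2 * i)
  ...   | yes n≤ = let g , dec , ok = select K _ n≤ in
                   inj₂ (g , StrictlyDecreasing⇒injective dec , λ k → proj₁ (ok k) , mixed k (ok k))
    where
    mixed : ∀ {a} k → a < K × hasTrue s (2 * a) ≡ true → Mixed s (2 * a)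
    mixed {a} _ (a<K , has) =
      isYes-true (anyUpTo? (λ j → s (2 * a) j ≟ᴮ true) m) has ,
      ¬RowIs⇒ {s} {2 * a} λ all → none (a , a<K , all)
  ...   | no  n≰ = ⊥-elim (<-irrefl refl (begin-strict
    K * m                              ≤⟨ heavy ⟩
    3 * weight s                       ≤⟨ *-monoʳ-≤ 3 (weight-≤ s) ⟩
    3 * (m * c)                        ≡⟨ x∙yz≈y∙xz 3 m c ⟩
    m * (3 * c)                        <⟨ *-monoʳ-< m {{>-nonZero 0<m}} 3c<K ⟩
    m * K                              ≡⟨ *-comm m K ⟩
    K * m                              ∎))
    where
    open ≤-Reasoning
    c = #[ i < K ] hasTrue s (2 * i)
    3c<K : 3 * c < K
    3c<K = <-≤-trans (*-monoʳ-< 3 (≰⇒> n≰)) 3n≤K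

  Gap : Grid → Set
  Gap s = ∃₂ λ a L → 0 < L × L ≤ n × a + L < K × RowIs s (2 * a) true × RowIs s (2 * (a + L)) false

  -- Among the n even rows following a true one, a monochromatic row lets us shrink the
  -- distance to the false row; if there is none, these n rows are mixed.
  narrow : ∀ s {a L} → Acc _<_ L → 0 < L → a + L < K →
           RowIs s (2 * a) true → RowIs s (2 * (a + L)) false → Gap s ⊎ MixedRows s
  narrow s {a} {L} (acc smaller) 0<L a+L<K top bottom with L ≤? n
  ... | yes L≤n = inj₁ (a , L , 0<L , L≤n , a+L<K , top , bottom)
  ... | no  L≰n with anyUpTo? (λ d → rowIs? s (2 * (a + suc d)) true ⊎-dec rowIs? s (2 * (a + suc d)) false) n
  ...   | yes (d , d<n , inj₂ false-row) =
            inj₁ (a , suc d , s≤s z≤n , d<n , ≤-<-trans (+-monoʳ-≤ a (<⇒≤ 1+d<L)) a+L<K ,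
                  top , false-row)
    where 1+d<L = <-≤-trans (s≤s d<n) (≰⇒> L≰n)
  ...   | yes (d , d<n , inj₁ true-row) =
            narrow s (smaller L′<L) (m<n⇒0<n∸m 1+d<L) (subst (_< K) (sym rejoin) a+L<K) true-row
                   (subst (λ r → RowIs s (2 * r) false) (sym rejoin) bottom)
    where
    1+d<L = <-≤-trans (s≤s d<n) (≰⇒> L≰n)
    L′<L : L ∸ suc d < L
    L′<L = ∸-monoʳ-< (s≤s z≤n) (<⇒≤ 1+d<L)
    rejoin : a + suc d + (L ∸ suc d) ≡ a + L
    rejoin = trans (+-assoc a (suc d) _) (cong (a +_) (m+[n∸m]≡n (<⇒≤ 1+d<L)))
  ...   | no  none = inj₂ (ρ , ρ-injective , λ k → ρ<K k , mixed k)
    where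
    ρ : Fin n → ℕ
    ρ k = a + suc (toℕ k)
    ρ-injective : ∀ {k l} → ρ k ≡ ρ l → k ≡ l
    ρ-injective eq = toℕ-injective (suc-injective (+-cancelˡ-≡ a _ _ eq))
    ρ<K : ∀ k → ρ k < K
    ρ<K k = <-trans (+-monoʳ-< a (<-≤-trans (s≤s (toℕ<n k)) (≰⇒> L≰n))) a+L<K
    mixed : ∀ k → Mixed s (2 * ρ k)
    mixed k = ¬RowIs⇒ {s} {2 * ρ k} (λ all → none (toℕ k , toℕ<n k , inj₂ all)) ,
              ¬RowIs⇒ {s} {2 * ρ k} (λ all → none (toℕ k , toℕ<n k , inj₁ all))

  -- Every column changes colour between the true row 2a and the false row 2(a + L); as
  -- there are fewer than m / n row changes on the way, one of them happens in n + 1 columns.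
  gap⇒switches : ∀ s → Gap s → Switches s
  gap⇒switches s (a , L , _ , L≤n , a+L<K , top , bottom) =
    switches-at (∑-pigeonhole (2 * L) n (λ d → #[ j < m ] cross d j) many)
    where
    cross : ℕ → ℕ → Bool
    cross d j = s (d + 2 * a) j ∧ not (s (suc (d + 2 * a)) j)
    2[a+L]≡ : 2 * (a + L) ≡ 2 * L + 2 * a
    2[a+L]≡ = trans (*-distribˡ-+ 2 a L) (+-comm (2 * a) (2 * L))
    column-crosses : ∀ {j} → j < m → 1 ≤ #[ d < 2 * L ] cross d j
    column-crosses {j} j<m
      with crossing (λ d → s (d + 2 * a) j) (2 * L) (top j<m)
                    (subst (λ r → s r j ≡ false) 2[a+L]≡ (bottom j<m))
    ... | d , d<2L , before , after = #-pos (2 * L) d<2L (cong₂ (λ c c′ → c ∧ not c′) before after)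
    many : 2 * L * n < ∑[ d < 2 * L ] #[ j < m ] cross d j
    many = begin-strict
      2 * L * n                               ≤⟨ *-monoˡ-≤ n (*-monoʳ-≤ 2 L≤n) ⟩
      2 * n * n                               ≡⟨ *-assoc 2 n n ⟩
      2 * (n * n)                             <⟨ *-monoʳ-< 2 n²<K ⟩
      m                                       ≡⟨ trans (∑-const m 1) (*-identityʳ m) ⟨
      ∑[ j < m ] 1                            ≤⟨ ∑-mono m column-crosses ⟩
      ∑[ j < m ] #[ d < 2 * L ] cross d j     ≡⟨ ∑-comm m (2 * L) (λ j d → bit (cross d j)) ⟩
      ∑[ d < 2 * L ] #[ j < m ] cross d j     ∎
      where open ≤-Reasoning
    switches-at : (∃ λ d → d < 2 * L × n < #[ j < m ] cross d j) → Switches s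
    switches-at (d , d<2L , n<#) with select m (cross d) n<#
    ... | g , dec , ok = d + 2 * a , true , g , row< , dec , λ k →
            proj₁ (ok k) , ∧-conicalˡ _ _ (proj₂ (ok k)) , not-injective (∧-conicalʳ _ _ (proj₂ (ok k)))
      where
      row< : suc (d + 2 * a) < m
      row< = ≤-<-trans (+-monoˡ-≤ (2 * a) d<2L) (subst (_< m) 2[a+L]≡ (*-monoʳ-< 2 a+L<K))

  complement-RowIs : ∀ {s r b} → RowIs s r b → RowIs (complement s) r (not b)
  complement-RowIs row j<m = cong not (row j<m)

  complement-MixedRows : ∀ {s} → MixedRows (complement s) → MixedRows s
  complement-MixedRows (ρ , ρ-injective , rows) = ρ , ρ-injective , λ k →
    let ρ<K , (j , j<m , t) , (j′ , j′<m , f) = rows k in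
    ρ<K , (j′ , j′<m , not-injective f) , (j , j<m , not-injective t)

  complement-Switches : ∀ {s} → Switches (complement s) → Switches s
  complement-Switches (i , b , g , i<m , dec , cols) = i , not b , g , i<m , dec , λ k →
    let g<m , this , next = cols k in
    g<m , not-injective (trans this (sym (not-involutive b))) ,
    not-injective (trans next (sym (not-involutive (not b))))

  true-above-false : ∀ s {a b} → a < b → b < K →
                     RowIs s (2 * a) true → RowIs s (2 * b) false → Switches s ⊎ MixedRows s
  true-above-false s {a} {b} a<b b<K top bottom =
    Sum.map₁ (gap⇒switches s)
      (narrow s (<-wellFounded _) (m<n⇒0<n∸m a<b) (subst (_< K) (sym a+L≡b) b<K) top
              (subst (λ r → RowIs s (2 * r) false) (sym a+L≡b) bottom))
    where a+L≡b = m+[n∸m]≡n (<⇒≤ a<b)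

  grid-lemma : ∀ s → Heavy s → Heavy (complement s) → Switches s ⊎ MixedRows s
  grid-lemma s heavy heavy′ with true-row-or-mixed s heavy | true-row-or-mixed (complement s) heavy′
  ... | inj₂ mixed | _          = inj₂ mixed
  ... | inj₁ _     | inj₂ mixed = inj₂ (complement-MixedRows {s} mixed)
  ... | inj₁ (a , a<K , top) | inj₁ (b , b<K , bottom) with <-cmp a b
  ...   | tri< a<b _ _ = true-above-false s a<b b<K top (λ j<m → not-injective (bottom j<m))
  ...   | tri≈ _ refl _ = contradiction (trans (sym (cong not (top 0<m))) (bottom 0<m)) λ ()
  ...   | tri> _ _ b<a = Sum.map (complement-Switches {s}) (complement-MixedRows {s})
                           (true-above-false (complement s) b<a a<K bottom (complement-RowIs {s} top))

-- Lower bounds on the cut-rank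

module ⊕ = Algebra.Properties.Semiring.Sum (CommutativeRing.semiring xor-∧-commutativeRing)

xorSum-cong : ∀ {k} {f g : Fin k → Bool} → (∀ i → f i ≡ g i) → xorSum f ≡ xorSum g
xorSum-cong {zero}  _   = refl
xorSum-cong {suc k} f≗g = cong₂ _xor_ (f≗g zero) (xorSum-cong (f≗g ∘ suc))

xorSum≡sum : ∀ {k} (f : Fin k → Bool) → xorSum f ≡ ⊕.sum f
xorSum≡sum {zero}  f = refl
xorSum≡sum {suc k} f = cong (f zero xor_) (xorSum≡sum (f ∘ suc))

xorSum-unit : ∀ {k} (c : Fin k → Bool) l → xorSum (λ i → c i ∧ eqFin i l) ≡ c l
xorSum-unit {suc k} c zero rewrite ∧-identityʳ (c zero) = begin
  c zero xor xorSum (λ i → c (suc i) ∧ false)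
    ≡⟨ cong (c zero xor_) (xorSum≡sum (λ i → c (suc i) ∧ false)) ⟩
  c zero xor ⊕.sum (λ i → c (suc i) ∧ false)
    ≡⟨ cong (c zero xor_) (⊕.sum-cong-≗ (∧-zeroʳ ∘ c ∘ suc)) ⟩
  c zero xor ⊕.sum {k} (λ _ → false)
    ≡⟨ cong (c zero xor_) (⊕.sum-replicate-zero k) ⟩
  c zero xor false
    ≡⟨ xor-identityʳ (c zero) ⟩
  c zero ∎
  where open ≡-Reasoning
xorSum-unit {suc k} c (suc l) rewrite ∧-zeroʳ (c zero) = xorSum-unit (c ∘ suc) l

-- If c ≠ 0 were orthogonal to all columns outside S, it would be orthogonal to their sums, among
-- them the unit vectors; so the rows r are independent.
cutRank-≥-of-unitColumns :
  ∀ {G : Graph} {S : Graph.V G → Set} {n w}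
  (r : Fin n → Graph.V G) (col : Fin n → Fin w → Graph.V G) →
  (∀ k → S (r k)) → (∀ l i → ¬ S (col l i)) →
  (∀ k l → xorSum (λ i → Graph.adj G (r k) (col l i)) ≡ eqFin k l) →
  CutRankAtLeast G S n
cutRank-≥-of-unitColumns {G} {n = n} {w} r col r∈S col∉S unit = r , r∈S , independent
  where
  open Graph G using (adj)
  independent : ∀ c → (∀ v → ¬ _ → xorSum (λ k → c k ∧ adj (r k) v) ≡ false) → ∀ l → c l ≡ false
  independent c orthogonal l = begin
    c l
      ≡⟨ xorSum-unit c l ⟨
    xorSum (λ k → c k ∧ eqFin k l)
      ≡⟨ xorSum≡sum (λ k → c k ∧ eqFin k l) ⟩
    ⊕.sum (λ k → c k ∧ eqFin k l)
      ≡⟨ ⊕.sum-cong-≗ (λ k → cong (c k ∧_) (trans (sym (unit k l)) (xorSum≡sum (column k)))) ⟩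
    ⊕.sum (λ k → c k ∧ ⊕.sum (column k))
      ≡⟨ ⊕.sum-cong-≗ (λ k → ⊕.*-distribˡ-sum (c k) (column k)) ⟩
    ⊕.sum (λ k → ⊕.sum (λ i → c k ∧ column k i))
      ≡⟨ ⊕.∑-comm (λ k i → c k ∧ column k i) ⟩
    ⊕.sum (λ i → ⊕.sum (λ k → c k ∧ column k i))
      ≡⟨ ⊕.sum-cong-≗ (λ i → trans (sym (xorSum≡sum (λ k → c k ∧ column k i))) (orthogonal _ (col∉S l i))) ⟩
    ⊕.sum {w} (λ _ → false)
      ≡⟨ ⊕.sum-replicate-zero w ⟩
    false ∎
    where
    open ≡-Reasoning
    column : Fin n → Fin w → Bool
    column k i = adj (r k) (col l i)

≡ᵇ-comm : ∀ a b → (a ≡ᵇ b) ≡ (b ≡ᵇ a)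
≡ᵇ-comm zero    zero    = refl
≡ᵇ-comm zero    (suc b) = refl
≡ᵇ-comm (suc a) zero    = refl
≡ᵇ-comm (suc a) (suc b) = ≡ᵇ-comm a b

≤ᵇ-true : ∀ {a b} → a ≤ b → (a ≤ᵇ b) ≡ true
≤ᵇ-true a≤b = Equivalence.to T-≡ (≤⇒≤ᵇ a≤b)

≤ᵇ-false : ∀ {a b} → b < a → (a ≤ᵇ b) ≡ false
≤ᵇ-false {a} {b} b<a with a ≤ᵇ b in eq
... | false = refl
... | true  = contradiction (≤ᵇ⇒≤ a b (Equivalence.from T-≡ eq)) (<⇒≱ b<a)

≤ᵇ-suc : ∀ a b → (suc a ≤ᵇ suc b) ≡ (a ≤ᵇ b)
≤ᵇ-suc zero    b = refl
≤ᵇ-suc (suc a) b = refl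

≤ᵇ-xor-suc≤ᵇ : ∀ a b → ((a ≤ᵇ b) xor (suc a ≤ᵇ b)) ≡ (a ≡ᵇ b)
≤ᵇ-xor-suc≤ᵇ a b with <-cmp a b
... | tri< a<b a≢b _ rewrite ≤ᵇ-true (<⇒≤ a<b) | ≤ᵇ-true a<b | ≡ᵇ-≢ a≢b = refl
... | tri≈ _ refl _  rewrite ≤ᵇ-true (≤-refl {a}) | ≤ᵇ-false (n<1+n a) | ≡ᵇ-refl a = refl
... | tri> _ a≢b b<a rewrite ≤ᵇ-false b<a | ≤ᵇ-false (m<n⇒m<1+n b<a) | ≡ᵇ-≢ a≢b = refl

module _ {r} {g : Fin r → ℕ} (dec : StrictlyDecreasing g) where

  decreasing-≡ᵇ : ∀ a b → (g a ≡ᵇ g b) ≡ eqFin a b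
  decreasing-≡ᵇ a b with a ≟ᶠ b
  ... | yes refl = trans (≡ᵇ-refl (g a)) (sym (eqFin-refl a))
  ... | no  a≢b  = trans (≡ᵇ-≢ (a≢b ∘ StrictlyDecreasing⇒injective dec)) (sym (eqFin-≢ a≢b))

  decreasing-≤ᵇ : ∀ a b → (g a ≤ᵇ g b) ≡ (toℕ b ≤ᵇ toℕ a)
  decreasing-≤ᵇ a b with <-cmp (toℕ a) (toℕ b)
  ... | tri< a<b _ _ = trans (≤ᵇ-false (dec a<b)) (sym (≤ᵇ-false a<b))
  ... | tri≈ _ a≡b _ rewrite toℕ-injective a≡b =
    trans (≤ᵇ-true (≤-refl {g b})) (sym (≤ᵇ-true (≤-refl {toℕ b})))
  ... | tri> _ _ b<a = trans (≤ᵇ-true (<⇒≤ (dec b<a))) (sym (≤ᵇ-true (<⇒≤ b<a)))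

record UnitColumns {p} (A : Fin p → Fin p → Bool) (n : ℕ) : Set where
  field
    width : ℕ
    row   : Fin n → Fin p
    col   : Fin n → Fin width → Fin p
    unit  : ∀ k l → xorSum (λ i → A (row k) (col l i)) ≡ eqFin k l

-- The link between consecutive layers, restricted to any n + 1 columns, has rank at least n
-- (in both orientations).
SwitchCertified : (ℕ → ℕ → Bool) → ℕ → Set
SwitchCertified link n = ∀ {g : Fin (suc n) → ℕ} → StrictlyDecreasing g →
  UnitColumns (λ a b → link (g a) (g b)) n × UnitColumns (λ a b → link (g b) (g a)) n

matching-certified : ∀ n → SwitchCertified _≡ᵇ_ n
matching-certified n {g} dec = cert (λ _ _ → refl) , cert (λ a b → ≡ᵇ-comm (g b) (g a))
  where
  cert : {A : Fin (suc n) → Fin (suc n) → Bool} → (∀ a b → A a b ≡ (g a ≡ᵇ g b)) → UnitColumns A n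
  cert A≡ = record
    { width = 1 ; row = suc ; col = λ l _ → suc l
    ; unit  = λ k l →
        trans (xor-identityʳ _) (trans (A≡ (suc k) (suc l)) (decreasing-≡ᵇ dec (suc k) (suc l))) }

-- On the rows 1, …, n, column 0 is all ones and column l + 1 misses only row l.
antimatching-certified : ∀ n → SwitchCertified (λ j j′ → not (j ≡ᵇ j′)) n
antimatching-certified n {g} dec = cert (λ a b → refl) , cert (λ a b → cong not (≡ᵇ-comm (g b) (g a)))
  where
  cert : {A : Fin (suc n) → Fin (suc n) → Bool} → (∀ a b → A a b ≡ not (g a ≡ᵇ g b)) → UnitColumns A n
  cert {A} A≡ = record
    { width = 2 ; row = suc ; col = λ { l zero → zero ; l (suc _) → suc l }
    ; unit  = λ k l → begin
        A (suc k) zero xor (A (suc k) (suc l) xor false)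
          ≡⟨ cong₂ (λ c c′ → c xor (c′ xor false)) (A≡ _ _) (A≡ _ _) ⟩
        not (g (suc k) ≡ᵇ g zero) xor (not (g (suc k) ≡ᵇ g (suc l)) xor false)
          ≡⟨ cong₂ (λ c c′ → not c xor (not c′ xor false)) (decreasing-≡ᵇ dec _ _) (decreasing-≡ᵇ dec _ _) ⟩
        not (not (eqFin k l) xor false)
          ≡⟨ cong not (xor-identityʳ _) ⟩
        not (not (eqFin k l))
          ≡⟨ not-involutive _ ⟩
        eqFin k l ∎ }
    where open ≡-Reasoning

-- As g decreases, entry (k, l) of the first matrix is [l ≤ k]; columns l and l + 1 differ only in row l.
half-graph-certified : ∀ n → SwitchCertified _≤ᵇ_ n
half-graph-certified n {g} dec =
  record { width = 2 ; row = inject₁ ; col = λ { l zero → inject₁ l ; l (suc _) → suc l }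
         ; unit = unit } ,
  record { width = 2 ; row = suc ; col = λ { l zero → suc l ; l (suc _) → inject₁ l }
         ; unit = unitᵀ }
  where
  open ≡-Reasoning
  unit : ∀ k l →
         (g (inject₁ k) ≤ᵇ g (inject₁ l)) xor ((g (inject₁ k) ≤ᵇ g (suc l)) xor false) ≡ eqFin k l
  unit k l = begin
    (g (inject₁ k) ≤ᵇ g (inject₁ l)) xor ((g (inject₁ k) ≤ᵇ g (suc l)) xor false)
      ≡⟨ cong₂ (λ c c′ → c xor (c′ xor false)) (decreasing-≤ᵇ dec _ _) (decreasing-≤ᵇ dec _ _) ⟩
    (toℕ (inject₁ l) ≤ᵇ toℕ (inject₁ k)) xor ((suc (toℕ l) ≤ᵇ toℕ (inject₁ k)) xor false)
      ≡⟨ cong₂ (λ a b → (a ≤ᵇ b) xor ((suc (toℕ l) ≤ᵇ b) xor false))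
               (toℕ-inject₁ l) (toℕ-inject₁ k) ⟩
    (toℕ l ≤ᵇ toℕ k) xor ((suc (toℕ l) ≤ᵇ toℕ k) xor false)
      ≡⟨ cong ((toℕ l ≤ᵇ toℕ k) xor_) (xor-identityʳ _) ⟩
    (toℕ l ≤ᵇ toℕ k) xor (suc (toℕ l) ≤ᵇ toℕ k)
      ≡⟨ ≤ᵇ-xor-suc≤ᵇ (toℕ l) (toℕ k) ⟩
    toℕ l ≡ᵇ toℕ k
      ≡⟨ ≡ᵇ-comm (toℕ l) (toℕ k) ⟩
    eqFin k l ∎
  unitᵀ : ∀ k l →
          (g (suc l) ≤ᵇ g (suc k)) xor ((g (inject₁ l) ≤ᵇ g (suc k)) xor false) ≡ eqFin k l
  unitᵀ k l = begin
    (g (suc l) ≤ᵇ g (suc k)) xor ((g (inject₁ l) ≤ᵇ g (suc k)) xor false)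
      ≡⟨ cong₂ (λ c c′ → c xor (c′ xor false)) (decreasing-≤ᵇ dec _ _) (decreasing-≤ᵇ dec _ _) ⟩
    (suc (toℕ k) ≤ᵇ suc (toℕ l)) xor ((suc (toℕ k) ≤ᵇ toℕ (inject₁ l)) xor false)
      ≡⟨ cong₂ (λ c b → c xor ((suc (toℕ k) ≤ᵇ b) xor false))
               (≤ᵇ-suc (toℕ k) (toℕ l)) (toℕ-inject₁ l) ⟩
    (toℕ k ≤ᵇ toℕ l) xor ((suc (toℕ k) ≤ᵇ toℕ l) xor false)
      ≡⟨ cong ((toℕ k ≤ᵇ toℕ l) xor_) (xor-identityʳ _) ⟩
    (toℕ k ≤ᵇ toℕ l) xor (suc (toℕ k) ≤ᵇ toℕ l)
      ≡⟨ ≤ᵇ-xor-suc≤ᵇ (toℕ k) (toℕ l) ⟩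
    eqFin k l ∎

-- Layered grids

isOdd-double : ∀ i → isOdd (2 * i) ≡ false
isOdd-double zero    = refl
isOdd-double (suc i) rewrite +-suc i (i + 0) = isOdd-double i

isOdd-1+double : ∀ i → isOdd (suc (2 * i)) ≡ true
isOdd-1+double zero    = refl
isOdd-1+double (suc i) rewrite +-suc i (i + 0) = isOdd-1+double i

odd≢even : ∀ a b → suc (2 * a) ≢ 2 * b
odd≢even a b eq = contradiction (trans (sym (isOdd-1+double a)) (trans (cong isOdd eq) (isOdd-double b))) λ ()

-- Adjacency of the vertex in layer i, column j to the one in layer i′, column j′ (counting
-- from 0): layers with `clique` are cliques, consecutive layers are joined along `link`.
layerAdj : (ℕ → Bool) → (ℕ → ℕ → Bool) → ℕ → ℕ → ℕ → ℕ → Bool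
layerAdj clique link i j i′ j′ = (clique i ∧ (i ≡ᵇ i′) ∧ not (j ≡ᵇ j′)) ∨ ((suc i ≡ᵇ i′) ∧ link j j′)

module LayerAdj (clique : ℕ → Bool) (link : ℕ → ℕ → Bool) where

  layerAdj-far : ∀ {i j i′ j′} → i ≢ i′ → suc i ≢ i′ → layerAdj clique link i j i′ j′ ≡ false
  layerAdj-far {i} i≢i′ 1+i≢i′ rewrite ≡ᵇ-≢ i≢i′ | ≡ᵇ-≢ 1+i≢i′ = trans (∨-identityʳ _) (∧-zeroʳ (clique i))

  layerAdj-clique : ∀ {i j j′} → clique i ≡ true → j ≢ j′ → layerAdj clique link i j i j′ ≡ true
  layerAdj-clique {i} clique-i j≢j′ rewrite clique-i | ≡ᵇ-refl i | ≡ᵇ-≢ j≢j′ = refl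

  layerAdj-next : ∀ {i j j′} → layerAdj clique link i j (suc i) j′ ≡ link j j′
  layerAdj-next {i} rewrite ≡ᵇ-≢ (≢-sym (1+n≢n {i})) | ≡ᵇ-refl i | ∧-zeroʳ (clique i) = refl

  layerAdj-prev : ∀ {i j j′} → layerAdj clique link (suc i) j′ i j ≡ false
  layerAdj-prev {i} = layerAdj-far (1+n≢n {i}) (≢-sym (<⇒≢ (m<n⇒m<1+n (n<1+n i))))

record LayeredGrid (G : Graph) (m : ℕ) : Set where
  field
    clique         : ℕ → Bool
    link           : ℕ → ℕ → Bool
    cell           : ℕ → ℕ → Graph.V G
    cell-injective : ∀ {i j j′} → j < m → j′ < m → cell i j ≡ cell i j′ → j ≡ j′
    adj-cell       : ∀ {i j i′ j′} → i < m → j < m → i′ < m → j′ < m →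
                     Graph.adj G (cell i j) (cell i′ j′) ≡
                       layerAdj clique link i j i′ j′ ∨ layerAdj clique link i′ j′ i j
    even-clique    : ∀ i → clique (2 * i) ≡ true

  open Graph G using (adj)
  open LayerAdj clique link

  even-rows-apart : ∀ {i i′ j j′} → i ≢ i′ → 2 * i < m → 2 * i′ < m → j < m → j′ < m →
                    adj (cell (2 * i) j) (cell (2 * i′) j′) ≡ false
  even-rows-apart {i} {i′} {j} {j′} i≢i′ i< i′< j< j′< = trans (adj-cell i< j< i′< j′<)
    (cong₂ _∨_ (layerAdj-far {j = j} {j′ = j′} (i≢i′ ∘ *-cancelˡ-≡ i i′ 2) (odd≢even i i′))
               (layerAdj-far {j = j′} {j′ = j} (i≢i′ ∘ sym ∘ *-cancelˡ-≡ i′ i 2) (odd≢even i′ i)))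

  even-row-clique : ∀ {i j j′} → 2 * i < m → j < m → j′ < m → j ≢ j′ →
                    adj (cell (2 * i) j) (cell (2 * i) j′) ≡ true
  even-row-clique {i} {j} {j′} i< j< j′< j≢j′ =
    trans (adj-cell i< j< i< j′<)
          (cong (_∨ layerAdj clique link (2 * i) j′ (2 * i) j) (layerAdj-clique (even-clique i) j≢j′))

  next-row : ∀ {i j j′} → suc i < m → j < m → j′ < m → adj (cell i j) (cell (suc i) j′) ≡ link j j′
  next-row {i} {j} {j′} 1+i< j< j′< = trans (adj-cell (<-trans (n<1+n i) 1+i<) j< 1+i< j′<)
    (trans (cong₂ _∨_ (layerAdj-next {i} {j} {j′}) (layerAdj-prev {i} {j} {j′})) (∨-identityʳ (link j j′)))

  prev-row : ∀ {i j j′} → suc i < m → j < m → j′ < m → adj (cell (suc i) j′) (cell i j) ≡ link j j′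
  prev-row {i} {j} {j′} 1+i< j< j′< = trans (adj-cell 1+i< j′< (<-trans (n<1+n i) 1+i<) j<)
    (cong₂ _∨_ (layerAdj-prev {i} {j} {j′}) (layerAdj-next {i} {j} {j′}))

-- Rank-width of layered grids

module _ {G : Graph} {n K : ℕ} (L : LayeredGrid G (2 * K))
         (2≤K : 2 ≤ K) (3n≤K : 3 * n ≤ K) (n²<K : n * n < K)
         (certified : SwitchCertified (LayeredGrid.link L) n) where

  open LayeredGrid L
  open GridLemma n K 3n≤K n²<K

  colouring : (Graph.V G → Bool) → Grid
  colouring p i j = p (cell i j)

  μ : (Graph.V G → Bool) → ℕ
  μ p = weight (colouring p)

  μ-mono : ∀ {p q} → p ⊆ q → μ p ≤ μ q
  μ-mono p⊆q = ∑-mono K (λ {i} _ → #-mono m (λ {j} _ → p⊆q {cell (2 * i) j}))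

  μ-∨ : ∀ p q → μ (λ g → p g ∨ q g) ≤ μ p + μ q
  μ-∨ p q = ≤-trans (∑-mono K (λ _ → #-∨ m _ _)) (≤-reflexive (∑-+ K _ _))

  μ-compl : ∀ p → K * m ≤ μ p + μ (not ∘ p)
  μ-compl p = ≤-reflexive (begin
    K * m                                                   ≡⟨ ∑-const K m ⟨
    ∑[ i < K ] m                                            ≡⟨ ∑-cong K (λ i → sym (#-compl m _)) ⟩
    ∑[ i < K ] (#[ j < m ] p (cell (2 * i) j) + #[ j < m ] not (p (cell (2 * i) j)))  ≡⟨ ∑-+ K _ _ ⟩
    μ p + μ (not ∘ p)                                       ∎)
    where open ≡-Reasoning

  μ-small : ∀ {p} → AtMostOne p → 3 * μ p < K * m
  μ-small {p} unique = begin-strict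
    3 * μ p        ≤⟨ *-monoʳ-≤ 3 μp≤K ⟩
    3 * K          <⟨ *-monoˡ-< K {{>-nonZero (<-≤-trans (s≤s z≤n) 2≤K)}} (≤-refl {4}) ⟩
    4 * K          ≤⟨ *-monoˡ-≤ K (*-monoʳ-≤ 2 2≤K) ⟩
    2 * K * K      ≡⟨ *-comm m K ⟩
    K * m          ∎
    where
    open ≤-Reasoning
    μp≤K : μ p ≤ K
    μp≤K = ≤-trans (∑-mono K λ {i} _ → #-≤1 m λ j< j′< pj pj′ → cell-injective {2 * i} j< j′< (unique pj pj′))
                   (≤-reflexive (trans (∑-const K 1) (*-identityʳ K)))

  module _ {S : Graph.V G → Set} (σ : Graph.V G → Bool)
           (sound : ∀ {g} → σ g ≡ true → S g) (complete : ∀ {g} → σ g ≡ false → ¬ S g) where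

    mixed-cutRank : MixedRows (colouring σ) → CutRankAtLeast G S n
    mixed-cutRank (ρ , ρ-injective , rows) =
      cutRank-≥-of-unitColumns {G} {w = 1} r (λ l _ → c l)
        (λ k → sound (r∈σ k)) (λ l _ → complete (c∉σ l)) unit
      where
      open Graph G using (adj)
      row< : ∀ k → 2 * ρ k < m
      row< k = *-monoʳ-< 2 (proj₁ (rows k))
      jᵗ jᶠ : Fin n → ℕ
      jᵗ k = proj₁ (proj₁ (proj₂ (rows k)))
      jᶠ k = proj₁ (proj₂ (proj₂ (rows k)))
      jᵗ< : ∀ k → jᵗ k < m
      jᵗ< k = proj₁ (proj₂ (proj₁ (proj₂ (rows k))))
      jᶠ< : ∀ k → jᶠ k < m
      jᶠ< k = proj₁ (proj₂ (proj₂ (proj₂ (rows k))))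
      r c : Fin n → Graph.V G
      r k = cell (2 * ρ k) (jᵗ k)
      c l = cell (2 * ρ l) (jᶠ l)
      r∈σ : ∀ k → σ (r k) ≡ true
      r∈σ k = proj₂ (proj₂ (proj₁ (proj₂ (rows k))))
      c∉σ : ∀ l → σ (c l) ≡ false
      c∉σ l = proj₂ (proj₂ (proj₂ (proj₂ (rows l))))
      jᵗ≢jᶠ : ∀ k → jᵗ k ≢ jᶠ k
      jᵗ≢jᶠ k eq = contradiction (trans (sym (r∈σ k)) (trans (cong (σ ∘ cell (2 * ρ k)) eq) (c∉σ k))) λ ()
      unit : ∀ k l → adj (r k) (c l) xor false ≡ eqFin k l
      unit k l with k ≟ᶠ l
      ... | yes refl = trans (xor-identityʳ _)
              (trans (even-row-clique {ρ k} (row< k) (jᵗ< k) (jᶠ< k) (jᵗ≢jᶠ k)) (sym (eqFin-refl k)))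
      ... | no  k≢l  = trans (xor-identityʳ _)
              (trans (even-rows-apart {ρ k} {ρ l} (k≢l ∘ ρ-injective) (row< k) (row< l) (jᵗ< k) (jᶠ< l))
                     (sym (eqFin-≢ k≢l)))

    switches-cutRank : Switches (colouring σ) → CutRankAtLeast G S n
    switches-cutRank (i , true , g , 1+i< , dec , cols) =
      cutRank-≥-of-unitColumns {G} (λ k → cell i (g (row k))) (λ l t → cell (suc i) (g (col l t)))
        (λ k → sound (proj₁ (proj₂ (cols (row k))))) (λ l t → complete (proj₂ (proj₂ (cols (col l t)))))
        (λ k l → trans (xorSum-cong λ t → next-row 1+i< (g< (row k)) (g< (col l t))) (unit k l))
      where
      open UnitColumns (proj₁ (certified dec))
      g< = proj₁ ∘ cols
    switches-cutRank (i , false , g , 1+i< , dec , cols) =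
      cutRank-≥-of-unitColumns {G} (λ k → cell (suc i) (g (row k))) (λ l t → cell i (g (col l t)))
        (λ k → sound (proj₂ (proj₂ (cols (row k))))) (λ l t → complete (proj₁ (proj₂ (cols (col l t)))))
        (λ k l → trans (xorSum-cong λ t → prev-row 1+i< (g< (col l t)) (g< (row k))) (unit k l))
      where
      open UnitColumns (proj₂ (certified dec))
      g< = proj₁ ∘ cols

  rankwidth-≥ : RankwidthAtLeast G n
  rankwidth-≥ D with balanced-edge μ (K * m) μ-mono μ-∨ μ-compl μ-small first≢second
    where
    open Sides D
    first≢second : cell 0 0 ≢ cell 0 1
    first≢second eq = contradiction (cell-injective 0<m 1<m eq) λ ()
      where 1<m = ≤-trans (s≤s (s≤s z≤n)) (*-monoʳ-≤ 2 (≤-trans (s≤s z≤n) 2≤K))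
  ... | u , v , uv , heavy , heavy′ =
    u , v , uv , [ switches-cutRank (σ u v) σ-sound (σ-complete uv)
                 , mixed-cutRank (σ u v) σ-sound (σ-complete uv) ]′
                 (grid-lemma (colouring (σ u v)) heavy (≤-trans heavy′ (*-monoʳ-≤ 3 (μ-mono {σ v u} other-side))))
    where
    open Sides D
    other-side : σ v u ⊆ (not ∘ σ u v)
    other-side {g} e = trans (sym (σ-swap uv g)) e

-- clamp i is the element i of Fin (suc p) when i ≤ p (larger i give junk).
clamp : ∀ {p} → ℕ → Fin (suc p)
clamp         zero    = zero
clamp {zero}  (suc i) = zero
clamp {suc p} (suc i) = suc (clamp i)

toℕ-clamp : ∀ {p i} → i < suc p → toℕ (clamp {p} i) ≡ i
toℕ-clamp {p}     {zero}  _         = refl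
toℕ-clamp {suc p} {suc i} (s≤s i≤p) = cong suc (toℕ-clamp i≤p)

layered : ∀ {G : Graph} {p} (vertex : Fin (suc p) → Fin (suc p) → Graph.V G) clique link →
          (∀ {a b b′} → vertex a b ≡ vertex a b′ → b ≡ b′) →
          (∀ a b a′ b′ → Graph.adj G (vertex a b) (vertex a′ b′) ≡
                           layerAdj clique link (toℕ a) (toℕ b) (toℕ a′) (toℕ b′) ∨
                           layerAdj clique link (toℕ a′) (toℕ b′) (toℕ a) (toℕ b)) →
          (∀ i → clique (2 * i) ≡ true) →
          LayeredGrid G (suc p)
layered {G} {p} vertex clique link vertex-injective adj-vertex even-clique = record
  { clique         = clique
  ; link           = link
  ; cell           = λ i j → vertex (clamp i) (clamp j)
  ; cell-injective = λ j< j′< eq →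
      trans (sym (toℕ-clamp j<)) (trans (cong toℕ (vertex-injective eq)) (toℕ-clamp j′<))
  ; adj-cell       = adj-cell
  ; even-clique    = even-clique
  }
  where
  adj-cell : ∀ {i j i′ j′} → i < suc p → j < suc p → i′ < suc p → j′ < suc p →
             Graph.adj G (vertex (clamp i) (clamp j)) (vertex (clamp i′) (clamp j′)) ≡
               layerAdj clique link i j i′ j′ ∨ layerAdj clique link i′ j′ i j
  adj-cell {i} {j} {i′} {j′} i< j< i′< j′<
    rewrite adj-vertex (clamp i) (clamp j) (clamp i′) (clamp j′)
          | toℕ-clamp i< | toℕ-clamp j< | toℕ-clamp i′< | toℕ-clamp j′< = refl

QMKI-layered : ∀ p → LayeredGrid (QMKI (suc p) (suc p)) (suc p)
QMKI-layered p = layered x (λ i → isOdd (suc i)) _≡ᵇ_ (λ { refl → refl }) (λ _ _ _ _ → refl) isOdd-1+double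

QMKK-layered : ∀ p → LayeredGrid (QMKK (suc p) (suc p)) (suc p)
QMKK-layered p = layered x (const true) _≡ᵇ_ (λ { refl → refl }) (λ _ _ _ _ → refl) (λ _ → refl)

QAKK-layered : ∀ p → LayeredGrid (QAKK (suc p) (suc p)) (suc p)
QAKK-layered p = layered x (const true) (λ j j′ → not (j ≡ᵇ j′)) (λ { refl → refl }) (λ _ _ _ _ → refl) (λ _ → refl)

QHKK-layered : ∀ p → LayeredGrid (QHKK (suc p) (suc p)) (suc p)
QHKK-layered p = layered x (const true) _≤ᵇ_ (λ { refl → refl }) (λ _ _ _ _ → refl) (λ _ → refl)


cliqueLayers : ℕ → ℕ
cliqueLayers n = 2 + (3 * n + n * n)

lemma8p7 : Σ (ℕ → ℕ) λ f → ((∀ n → 1 ≤ f n) ×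
             (∀ n → 1 ≤ n →
                RankwidthAtLeast (QMKI (f n) (f n)) n ×
                RankwidthAtLeast (QMKK (f n) (f n)) n ×
                RankwidthAtLeast (QAKK (f n) (f n)) n ×
                RankwidthAtLeast (QHKK (f n) (f n)) n))
lemma8p7 = (λ n → 2 * cliqueLayers n) , (λ _ → s≤s z≤n) , λ n _ →
  rankwidth-≥ {K = cliqueLayers n} (QMKI-layered _) (2≤ n) (3n≤ n) (n²< n) (matching-certified n) ,
  rankwidth-≥ {K = cliqueLayers n} (QMKK-layered _) (2≤ n) (3n≤ n) (n²< n) (matching-certified n) ,
  rankwidth-≥ {K = cliqueLayers n} (QAKK-layered _) (2≤ n) (3n≤ n) (n²< n) (antimatching-certified n) ,
  rankwidth-≥ {K = cliqueLayers n} (QHKK-layered _) (2≤ n) (3n≤ n) (n²< n) (half-graph-certified n)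
  where
  2≤ : ∀ n → 2 ≤ cliqueLayers n
  2≤ _ = s≤s (s≤s z≤n)
  3n≤ : ∀ n → 3 * n ≤ cliqueLayers n
  3n≤ n = ≤-trans (m≤m+n (3 * n) (n * n)) (m≤n+m _ 2)
  n²< : ∀ n → n * n < cliqueLayers n
  n²< n = ≤-trans (m≤n+m (suc (n * n)) (3 * n)) (≤-trans (≤-reflexive (+-suc (3 * n) (n * n))) (n≤1+n _))
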